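{- Let $(T,\eta,\mu)$ be a localisable monad on a stiff symmetric monoidal category $\mathcal{C}$. Then $T$ induces a formal monad on $\overline{\mathcal{C}}$ in $[\mathrm{ZI}(\mathcal{C})^{\mathrm{op}},\mathbf{Cat}]$: the natural transformation $\overline{T}\colon\overline{\mathcal{C}}\Rightarrow\overline{\mathcal{C}}$ has components $T|_u$, the modification $\overline{\eta}\colon\mathrm{id}_{\overline{\mathcal{C}}}\Rrightarrow\overline{T}$ has components $\eta|_u$, and the modification $\overline{\mu}\colon\overline{T}^2\Rrightarrow\overline{T}$ has components $\mu|_u$.
   Context: Let $\mathcal{C}$ be a symmetric monoidal category with unit $I$, unitors $\lambda,\rho$, associator $\alpha$ and symmetry $\sigma$ (coherence isomorphisms often suppressed). A central idempotent is a morphism $u\colon U\to I$ such that $\rho_U\circ(U\otimes u)=\lambda_U\circ(u\otimes U)\colon U\otimes U\to U$ and this morphism is invertible; $u,v$ are identified when $u=v\circ m$ for an isomorphism $m$. $\mathrm{ZI}(\mathcal{C})$ is the meet-semilattice of central idempotents, $u\leq v$ iff $u=v\circ m$ for some morphism $m$, regarded as a poset category. $\mathcal{C}|_u$ is the category with the objects of $\mathcal{C}$, morphisms $A\to B$ being morphisms $A\otimes U\to B$, composition of $f\colon A\otimes U\to B$ and $g\colon B\otimes U\to C$ given by $g\circ(f\otimes U)\circ(A\otimes U\otimes u)^{ -1}$, identity $A\otimes u$. For $u\leq v$ with $u=v\circ m$, $\mathcal{C}|_{u\leq v}\colon\mathcal{C}|_v\to\mathcal{C}|_u$ is $A\mapsto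 A$, $f\mapsto f\circ(A\otimes m)$. $\mathcal{C}$ is stiff when for every object $A$ and central idempotents $u,v$ the square with vertices $A\otimes U\otimes V$, $A\otimes V$, $A\otimes U$, $A$ (bottom edge $A\otimes u$, right edge $A\otimes v$) is a pullback. A monad $(T,\eta,\mu)$ on $\mathcal{C}$ is localisable when there are morphisms $\mathrm{st}_{A,U}\colon T(A)\otimes U\to T(A\otimes U)$ for each object $A$ and central idempotent $u$ with: $T(\rho_A)\circ\mathrm{st}_{A,I}=\rho_{T(A)}$; $T(\alpha_{A,U,V})\circ\mathrm{st}_{A,U\otimes V}=\mathrm{st}_{A\otimes U,V}\circ(\mathrm{st}_{A,U}\otimes V)\circ\alpha_{TA,U,V}$; $\eta_{A\otimes U}=\mathrm{st}_{A,U}\circ(\eta_A\otimes U)$; $\mu_{A\otimes U}\circ T(\mathrm{st}_{A,U})\circ\mathrm{st}_{T(A),U}=\mathrm{st}_{A,U}\circ(\mu_A\otimes U)$; $\mathrm{st}_{A,V}\circ(T(A)\otimes m)=T(A\otimes m)\circ\mathrm{st}_{A,U}$ whenever $u=v\circ m$; $\mathrm{st}_{B,U}\circ(T(f)\otimes U)=T(f\otimes U)\circ\mathrm{st}_{A,U}$ for all $f\colon A\to B$. $T|_u$ is the monad on $\mathcal{C}|_u$ with $T|_u(A)=T(A)$, $T|_u(f\colon A\otimes U\to B)=T(f)\circ\mathrm{st}_{A,U}$, unit $(\eta|_u)_A=\eta_A\otimes u$ and multiplication $(\mu|_u)_A=\mu_A\otimes u$. $\overline{\mathcal{C}}\colon\mathrm{ZI}(\mathcal{C})^{\mathrm{op}}\to\mathbf{Cat}$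 sends $u\mapsto\mathcal{C}|_u$ and $(u\leq v)\mapsto\mathcal{C}|_{u\leq v}$. The 2-category $[\mathrm{ZI}(\mathcal{C})^{\mathrm{op}},\mathbf{Cat}]$ has functors, natural transformations and modifications as 0-, 1- and 2-cells; a formal monad on $\overline{\mathcal{C}}$ is a 1-cell $\overline{T}\colon\overline{\mathcal{C}}\Rightarrow\overline{\mathcal{C}}$ with 2-cells $\overline{\eta}\colon\mathrm{id}\Rrightarrow\overline{T}$, $\overline{\mu}\colon\overline{T}\,\overline{T}\Rrightarrow\overline{T}$ satisfying the monad laws. Concretely: monads $(T_u,\eta_u,\mu_u)$ on $\mathcal{C}|_u$ such that for all $u\leq v$, $T_u\circ\mathcal{C}|_{u\leq v}=\mathcal{C}|_{u\leq v}\circ T_v$ as functors, $(\eta_u)_{\mathcal{C}|_{u\leq v}A}=\mathcal{C}|_{u\leq v}((\eta_v)_A)$ and $(\mu_u)_{\mathcal{C}|_{u\leq v}A}=\mathcal{C}|_{u\leq v}((\mu_v)_A)$. -}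

module Defs where

open import Level using (Level; _⊔_; suc)
open import Data.Product using (Σ; _×_; _,_)
open import Relation.Binary using (IsEquivalence)

private
  variable
    o ℓ e : Level

record Category (o ℓ e : Level) : Set (suc (o ⊔ ℓ ⊔ e)) where
  infixr 9 _∘_
  infix  4 _≈_
  field
    Obj : Set o
    Hom : Obj → Obj → Set ℓ
    _≈_ : ∀ {A B} → Hom A B → Hom A B → Set e
    id  : ∀ {A} → Hom A A
    _∘_ : ∀ {A B C} → Hom B C → Hom A B → Hom A C
    equiv     : ∀ {A B} → IsEquivalence (_≈_ {A} {B})
    assoc     : ∀ {A B C D} {f : Hom A B} {g : Hom B C} {h : Hom C D} →
                (h ∘ g) ∘ f ≈ h ∘ (g ∘ f)
    identityˡ : ∀ {A B} {f : Hom A B} → id ∘ f ≈ f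
    identityʳ : ∀ {A B} {f : Hom A B} → f ∘ id ≈ f
    ∘-resp-≈  : ∀ {A B C} {f h : Hom B C} {g i : Hom A B} →
                f ≈ h → g ≈ i → f ∘ g ≈ h ∘ i

-- Symmetric monoidal categories.
-- Convention (as in the paper's localisability axiom):
--   α A B C : A ⊗ (B ⊗ C) → (A ⊗ B) ⊗ C,  lam A : I ⊗ A → A,  rho A : A ⊗ I → A.

record SymmetricMonoidalCategory (o ℓ e : Level) : Set (suc (o ⊔ ℓ ⊔ e)) where
  infixr 10 _⊗₀_ _⊗₁_
  field
    category : Category o ℓ e
  open Category category public
  field
    _⊗₀_ : Obj → Obj → Obj
    _⊗₁_ : ∀ {A B C D} → Hom A B → Hom C D → Hom (A ⊗₀ C) (B ⊗₀ D)
    ⊗-identity : ∀ {A B} → (id {A}) ⊗₁ (id {B}) ≈ id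
    ⊗-homomorphism : ∀ {A B C D E F} {f : Hom A B} {g : Hom B C}
                       {h : Hom D E} {k : Hom E F} →
                     (g ∘ f) ⊗₁ (k ∘ h) ≈ (g ⊗₁ k) ∘ (f ⊗₁ h)
    ⊗-resp-≈ : ∀ {A B C D} {f f' : Hom A B} {g g' : Hom C D} →
               f ≈ f' → g ≈ g' → f ⊗₁ g ≈ f' ⊗₁ g'

    I : Obj

    lam     : ∀ A → Hom (I ⊗₀ A) A
    lam⁻¹   : ∀ A → Hom A (I ⊗₀ A)
    lam-isoˡ : ∀ {A} → lam⁻¹ A ∘ lam A ≈ id
    lam-isoʳ : ∀ {A} → lam A ∘ lam⁻¹ A ≈ id
    lam-natural : ∀ {A B} {f : Hom A B} → lam B ∘ (id ⊗₁ f) ≈ f ∘ lam A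

    rho     : ∀ A → Hom (A ⊗₀ I) A
    rho⁻¹   : ∀ A → Hom A (A ⊗₀ I)
    rho-isoˡ : ∀ {A} → rho⁻¹ A ∘ rho A ≈ id
    rho-isoʳ : ∀ {A} → rho A ∘ rho⁻¹ A ≈ id
    rho-natural : ∀ {A B} {f : Hom A B} → rho B ∘ (f ⊗₁ id) ≈ f ∘ rho A

    α     : ∀ A B C → Hom (A ⊗₀ (B ⊗₀ C)) ((A ⊗₀ B) ⊗₀ C)
    α⁻¹   : ∀ A B C → Hom ((A ⊗₀ B) ⊗₀ C) (A ⊗₀ (B ⊗₀ C))
    α-isoˡ : ∀ {A B C} → α⁻¹ A B C ∘ α A B C ≈ id
    α-isoʳ : ∀ {A B C} → α A B C ∘ α⁻¹ A B C ≈ id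
    α-natural : ∀ {A B C D E F} {f : Hom A D} {g : Hom B E} {h : Hom C F} →
                α D E F ∘ (f ⊗₁ (g ⊗₁ h)) ≈ ((f ⊗₁ g) ⊗₁ h) ∘ α A B C

    triangle : ∀ {A B} → (rho A ⊗₁ id {B}) ∘ α A I B ≈ id {A} ⊗₁ lam B
    pentagon : ∀ {A B C D} →
               α (A ⊗₀ B) C D ∘ α A B (C ⊗₀ D)
                 ≈ (α A B C ⊗₁ id {D}) ∘ (α A (B ⊗₀ C) D ∘ (id {A} ⊗₁ α B C D))

    σ : ∀ A B → Hom (A ⊗₀ B) (B ⊗₀ A)
    σ-natural : ∀ {A B C D} {f : Hom A C} {g : Hom B D} →
                σ C D ∘ (f ⊗₁ g) ≈ (g ⊗₁ f) ∘ σ A B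
    σ-involutive : ∀ {A B} → σ B A ∘ σ A B ≈ id
    hexagon : ∀ {A B C} →
              α⁻¹ B C A ∘ (σ A (B ⊗₀ C) ∘ α⁻¹ A B C)
                ≈ (id {B} ⊗₁ σ A C) ∘ (α⁻¹ B A C ∘ (σ A B ⊗₁ id {C}))

module _ (C : SymmetricMonoidalCategory o ℓ e) where
  open SymmetricMonoidalCategory C

  record IsCentralIdem {U : Obj} (u : Hom U I) : Set (ℓ ⊔ e) where
    field
      central : rho U ∘ (id ⊗₁ u) ≈ lam U ∘ (u ⊗₁ id)
      diag⁻¹  : Hom U (U ⊗₀ U)
      diag-isoˡ : diag⁻¹ ∘ (rho U ∘ (id ⊗₁ u)) ≈ id
      diag-isoʳ : (rho U ∘ (id ⊗₁ u)) ∘ diag⁻¹ ≈ id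

  record CentralIdem : Set (o ⊔ ℓ ⊔ e) where
    field
      U     : Obj
      u     : Hom U I
      isCI  : IsCentralIdem u
    open IsCentralIdem isCI public

  record IsPullback {P X Y Z : Obj} (top : Hom P Y) (left : Hom P X)
                    (bot : Hom X Z) (right : Hom Y Z) : Set (o ⊔ ℓ ⊔ e) where
    field
      commute   : right ∘ top ≈ bot ∘ left
      universal : ∀ {Q} (f : Hom Q Y) (g : Hom Q X) → right ∘ f ≈ bot ∘ g →
                  Σ (Hom Q P) λ h →
                    (top ∘ h ≈ f × left ∘ h ≈ g) ×
                    (∀ (h' : Hom Q P) → top ∘ h' ≈ f → left ∘ h' ≈ g → h' ≈ h)

  _⊗ci_ : ∀ (A : Obj) {U : Obj} → Hom U I → Hom (A ⊗₀ U) A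
  A ⊗ci u = rho A ∘ (id ⊗₁ u)

  Stiff : Set (o ⊔ ℓ ⊔ e)
  Stiff = ∀ (A : Obj) (u v : CentralIdem) →
    let open CentralIdem u renaming (U to U'; u to u')
        open CentralIdem v renaming (U to V'; u to v')
    in IsPullback (id {A} ⊗₁ (lam V' ∘ (u' ⊗₁ id {V'})))
                  (id {A} ⊗₁ (rho U' ∘ (id {U'} ⊗₁ v')))
                  (A ⊗ci u') (A ⊗ci v')

  record Monad : Set (o ⊔ ℓ ⊔ e) where
    field
      T₀ : Obj → Obj
      T₁ : ∀ {A B} → Hom A B → Hom (T₀ A) (T₀ B)
      T-identity : ∀ {A} → T₁ (id {A}) ≈ id
      T-homomorphism : ∀ {A B C} {f : Hom A B} {g : Hom B C} →
                       T₁ (g ∘ f) ≈ T₁ g ∘ T₁ f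
      T-resp-≈ : ∀ {A B} {f g : Hom A B} → f ≈ g → T₁ f ≈ T₁ g
      η : ∀ A → Hom A (T₀ A)
      μ : ∀ A → Hom (T₀ (T₀ A)) (T₀ A)
      η-natural : ∀ {A B} {f : Hom A B} → η B ∘ f ≈ T₁ f ∘ η A
      μ-natural : ∀ {A B} {f : Hom A B} → μ B ∘ T₁ (T₁ f) ≈ T₁ f ∘ μ A
      identityˡ-M : ∀ {A} → μ A ∘ T₁ (η A) ≈ id
      identityʳ-M : ∀ {A} → μ A ∘ η (T₀ A) ≈ id
      assoc-M : ∀ {A} → μ A ∘ T₁ (μ A) ≈ μ A ∘ μ (T₀ A)

  -- The strength st A u is indexed by the central
  -- idempotent u : U → I; the proof that u is a central idempotent is an
  -- irrelevant argument, so st depends only on A and the morphism u.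
  record Localisable (M : Monad) : Set (o ⊔ ℓ ⊔ e) where
    open Monad M
    field
      st : ∀ (A : Obj) {U : Obj} (u : Hom U I) → .(IsCentralIdem u) →
           Hom (T₀ A ⊗₀ U) (T₀ (A ⊗₀ U))
      st-unit : ∀ (A : Obj) .(p : IsCentralIdem (id {I})) →
                T₁ (rho A) ∘ st A id p ≈ rho (T₀ A)
      st-assoc : ∀ (A : Obj) {U V : Obj} (u : Hom U I) (v : Hom V I)
                 .(pu : IsCentralIdem u) .(pv : IsCentralIdem v)
                 .(puv : IsCentralIdem (rho I ∘ (u ⊗₁ v))) →
                 T₁ (α A U V) ∘ st A (rho I ∘ (u ⊗₁ v)) puv
                   ≈ st (A ⊗₀ U) v pv ∘ ((st A u pu ⊗₁ id {V}) ∘ α (T₀ A) U V)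
      st-η : ∀ (A : Obj) {U : Obj} (u : Hom U I) .(p : IsCentralIdem u) →
             η (A ⊗₀ U) ≈ st A u p ∘ (η A ⊗₁ id {U})
      st-μ : ∀ (A : Obj) {U : Obj} (u : Hom U I) .(p : IsCentralIdem u) →
             μ (A ⊗₀ U) ∘ (T₁ (st A u p) ∘ st (T₀ A) u p)
               ≈ st A u p ∘ (μ A ⊗₁ id {U})
      st-m : ∀ (A : Obj) {U V : Obj} (u : Hom U I) (v : Hom V I) (m : Hom U V)
             .(pu : IsCentralIdem u) .(pv : IsCentralIdem v) →
             u ≈ v ∘ m →
             st A v pv ∘ (id {T₀ A} ⊗₁ m) ≈ T₁ (id {A} ⊗₁ m) ∘ st A u pu
      st-natural : ∀ {A B : Obj} (f : Hom A B) {U : Obj} (u : Hom U I)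
                   .(p : IsCentralIdem u) →
                   st B u p ∘ (T₁ f ⊗₁ id {U}) ≈ T₁ (f ⊗₁ id {U}) ∘ st A u p

  -- The restricted category C|_u (given by its hom-sets, identities and
  -- composition) and the restriction functors C|_{u ≤ v}.

  module Restriction (w : CentralIdem) where
    open CentralIdem w

    Hom∣ : Obj → Obj → Set ℓ
    Hom∣ A B = Hom (A ⊗₀ U) B

    id∣ : ∀ A → Hom∣ A A
    id∣ A = A ⊗ci u

    infixr 9 _∘∣_
    _∘∣_ : ∀ {A B D} → Hom∣ B D → Hom∣ A B → Hom∣ A D
    _∘∣_ {A} g f = g ∘ ((f ⊗₁ id {U}) ∘ (α A U U ∘ (id {A} ⊗₁ diag⁻¹)))

  -- C|_{u ≤ v} on morphisms, for u = v ∘ m :  f ↦ f ∘ (A ⊗ m)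
  restrict : ∀ {U V A B : Obj} (m : Hom U V) → Hom (A ⊗₀ V) B → Hom (A ⊗₀ U) B
  restrict m f = f ∘ (id ⊗₁ m)

  module Restricted (M : Monad) (L : Localisable M) (w : CentralIdem) where
    open Monad M
    open Localisable L
    open CentralIdem w
    open Restriction w

    T∣ : ∀ {A B} → Hom∣ A B → Hom∣ (T₀ A) (T₀ B)
    T∣ {A} f = T₁ f ∘ st A u isCI

    η∣ : ∀ A → Hom∣ A (T₀ A)
    η∣ A = rho (T₀ A) ∘ (η A ⊗₁ u)

    μ∣ : ∀ A → Hom∣ (T₀ (T₀ A)) (T₀ A)
    μ∣ A = rho (T₀ A) ∘ (μ A ⊗₁ u)

    record IsMonadOnRestriction : Set (o ⊔ ℓ ⊔ e) where
      field
        identity     : ∀ {A} → T∣ (id∣ A) ≈ id∣ (T₀ A)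
        homomorphism : ∀ {A B D} {f : Hom∣ A B} {g : Hom∣ B D} →
                       T∣ (g ∘∣ f) ≈ T∣ g ∘∣ T∣ f
        resp-≈       : ∀ {A B} {f g : Hom∣ A B} → f ≈ g → T∣ f ≈ T∣ g
        η∣-natural   : ∀ {A B} {f : Hom∣ A B} → η∣ B ∘∣ f ≈ T∣ f ∘∣ η∣ A
        μ∣-natural   : ∀ {A B} {f : Hom∣ A B} →
                       μ∣ B ∘∣ T∣ (T∣ f) ≈ T∣ f ∘∣ μ∣ A
        identityˡ∣   : ∀ {A} → μ∣ A ∘∣ T∣ (η∣ A) ≈ id∣ (T₀ A)
        identityʳ∣   : ∀ {A} → μ∣ A ∘∣ η∣ (T₀ A) ≈ id∣ (T₀ A)
        assoc∣       : ∀ {A} → μ∣ A ∘∣ T∣ (μ∣ A) ≈ μ∣ A ∘∣ μ∣ (T₀ A)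

  record CompatibleRestriction (M : Monad) (L : Localisable M)
         (u v : CentralIdem) (m : Hom (CentralIdem.U u) (CentralIdem.U v))
         : Set (o ⊔ ℓ ⊔ e) where
    open Monad M
    open CentralIdem u using () renaming (U to Uu)
    open CentralIdem v using () renaming (U to Uv)
    module Ru = Restricted M L u
    module Rv = Restricted M L v
    field
      T-commutes : ∀ {A B} (f : Hom (A ⊗₀ Uv) B) →
                   Ru.T∣ (restrict m f) ≈ restrict m (Rv.T∣ f)
      η-commutes : ∀ A → Ru.η∣ A ≈ restrict m (Rv.η∣ A)
      μ-commutes : ∀ A → Ru.μ∣ A ≈ restrict m (Rv.μ∣ A)

  InducesFormalMonad : (M : Monad) → Localisable M → Set (o ⊔ ℓ ⊔ e)
  InducesFormalMonad M L =
    (∀ (w : CentralIdem) → Restricted.IsMonadOnRestriction M L w) ×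
    (∀ (u v : CentralIdem) (m : Hom (CentralIdem.U u) (CentralIdem.U v)) →
       CentralIdem.u u ≈ CentralIdem.u v ∘ m →
       CompatibleRestriction M L u v m)

{-# OPTIONS --safe #-}
-- For a central idempotent u : U → I, the functor − ⊗ U is a comonad with
-- counit A ⊗ u and comultiplication δ_A = α ∘ (A ⊗ (U ⊗ u)⁻¹), and C|_u is
-- its co-Kleisli category.  The strength st_{−,U} of a localisable monad is
-- compatible with this counit (by st-unit and st-m along u = id ∘ u) and
-- comultiplication (by st-assoc and st-m along u = (u ⊗ u) ∘ (U ⊗ u)⁻¹), so it
-- is a distributive law and T lifts to the co-Kleisli category as T|_u.
-- Every morphism occurring in the monad laws for T|_u has the form h ∘ (A ⊗ u),
-- so those laws reduce to the laws of T and of the strength.  Compatibility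
-- with C|_{u ≤ v} is the axiom st-m.
module Submission where

open import Level using (Level)
open import Data.Product using (_,_)
open import Relation.Binary using (IsEquivalence; Setoid)
import Relation.Binary.Reasoning.Setoid as SetoidReasoning
open import Defs

module CategoryReasoning {o ℓ e : Level} (𝒞 : Category o ℓ e) where
  open Category 𝒞

  module ≈ {A B : Obj} = IsEquivalence (equiv {A} {B})

  hom-setoid : Obj → Obj → Setoid ℓ e
  hom-setoid A B = record { Carrier = Hom A B ; _≈_ = _≈_ ; isEquivalence = equiv }

  module HomReasoning {A B : Obj} = SetoidReasoning (hom-setoid A B)
  open HomReasoning public

  infixr 4 _⟩∘⟨_ refl⟩∘⟨_
  infixl 5 _⟩∘⟨refl

  _⟩∘⟨_ : ∀ {A B D} {f h : Hom B D} {g i : Hom A B} → f ≈ h → g ≈ i → f ∘ g ≈ h ∘ i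
  _⟩∘⟨_ = ∘-resp-≈

  refl⟩∘⟨_ : ∀ {A B D} {f : Hom B D} {g i : Hom A B} → g ≈ i → f ∘ g ≈ f ∘ i
  refl⟩∘⟨ p = ∘-resp-≈ ≈.refl p

  _⟩∘⟨refl : ∀ {A B D} {f h : Hom B D} {g : Hom A B} → f ≈ h → f ∘ g ≈ h ∘ g
  p ⟩∘⟨refl = ∘-resp-≈ p ≈.refl

  sym-assoc : ∀ {A B D E} {f : Hom A B} {g : Hom B D} {h : Hom D E} →
              h ∘ (g ∘ f) ≈ (h ∘ g) ∘ f
  sym-assoc = ≈.sym assoc

  pullˡ : ∀ {X A B D} {a : Hom B D} {b : Hom A B} {c : Hom A D} {f : Hom X A} →
          a ∘ b ≈ c → a ∘ (b ∘ f) ≈ c ∘ f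
  pullˡ p = ≈.trans sym-assoc (p ⟩∘⟨refl)

  pullʳ : ∀ {X A B D} {a : Hom B D} {b : Hom A B} {c : Hom X A} {d : Hom X B} →
          b ∘ c ≈ d → (a ∘ b) ∘ c ≈ a ∘ d
  pullʳ p = ≈.trans assoc (refl⟩∘⟨ p)

  elimˡ : ∀ {A B} {a : Hom B B} {f : Hom A B} → a ≈ id → a ∘ f ≈ f
  elimˡ p = ≈.trans (p ⟩∘⟨refl) identityˡ

  elimʳ : ∀ {A B} {a : Hom A A} {f : Hom A B} → a ≈ id → f ∘ a ≈ f
  elimʳ p = ≈.trans (refl⟩∘⟨ p) identityʳ

  split-epi-cancel : ∀ {X A B} {φ : Hom A B} {ψ : Hom B A} {f g : Hom B X} →
                     φ ∘ ψ ≈ id → f ∘ φ ≈ g ∘ φ → f ≈ g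
  split-epi-cancel {φ = φ} {ψ} {f} {g} φψ p = begin
    f           ≈⟨ ≈.sym (elimʳ φψ) ⟩
    f ∘ (φ ∘ ψ) ≈⟨ pullˡ p ⟩
    (g ∘ φ) ∘ ψ ≈⟨ pullʳ φψ ⟩
    g ∘ id      ≈⟨ identityʳ ⟩
    g           ∎

  split-mono-cancel : ∀ {X A B} {φ : Hom A B} {ψ : Hom B A} {f g : Hom X A} →
                      ψ ∘ φ ≈ id → φ ∘ f ≈ φ ∘ g → f ≈ g
  split-mono-cancel {φ = φ} {ψ} {f} {g} ψφ p = begin
    f           ≈⟨ ≈.sym (elimˡ ψφ) ⟩
    (ψ ∘ φ) ∘ f ≈⟨ pullʳ p ⟩
    ψ ∘ (φ ∘ g) ≈⟨ pullˡ ψφ ⟩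
    id ∘ g      ≈⟨ identityˡ ⟩
    g           ∎

  inverse-∘ : ∀ {A B D} {f : Hom B D} {f⁻¹ : Hom D B} {g : Hom A B} {g⁻¹ : Hom B A} →
              f ∘ f⁻¹ ≈ id → g ∘ g⁻¹ ≈ id → (f ∘ g) ∘ (g⁻¹ ∘ f⁻¹) ≈ id
  inverse-∘ {f = f} {f⁻¹} {g} {g⁻¹} ff⁻¹ gg⁻¹ = begin
    (f ∘ g) ∘ (g⁻¹ ∘ f⁻¹) ≈⟨ assoc ⟩
    f ∘ (g ∘ (g⁻¹ ∘ f⁻¹)) ≈⟨ refl⟩∘⟨ pullˡ gg⁻¹ ⟩
    f ∘ (id ∘ f⁻¹)        ≈⟨ refl⟩∘⟨ identityˡ ⟩
    f ∘ f⁻¹               ≈⟨ ff⁻¹ ⟩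
    id                    ∎

  inverse-∘₃ : ∀ {A B D E} {f : Hom D E} {f⁻¹ : Hom E D} {g : Hom B D} {g⁻¹ : Hom D B}
               {h : Hom A B} {h⁻¹ : Hom B A} →
               f ∘ f⁻¹ ≈ id → g ∘ g⁻¹ ≈ id → h ∘ h⁻¹ ≈ id →
               (f ∘ (g ∘ h)) ∘ (h⁻¹ ∘ (g⁻¹ ∘ f⁻¹)) ≈ id
  inverse-∘₃ ff⁻¹ gg⁻¹ hh⁻¹ =
    ≈.trans (refl⟩∘⟨ sym-assoc) (inverse-∘ ff⁻¹ (inverse-∘ gg⁻¹ hh⁻¹))

module MonoidalReasoning {o ℓ e : Level} (C : SymmetricMonoidalCategory o ℓ e) where
  open SymmetricMonoidalCategory C
  open CategoryReasoning category public

  ⊗-respˡ : ∀ {A B X Y} {f f′ : Hom A B} {g : Hom X Y} → f ≈ f′ → f ⊗₁ g ≈ f′ ⊗₁ g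
  ⊗-respˡ p = ⊗-resp-≈ p ≈.refl

  ⊗-respʳ : ∀ {A B X Y} {f : Hom A B} {g g′ : Hom X Y} → g ≈ g′ → f ⊗₁ g ≈ f ⊗₁ g′
  ⊗-respʳ p = ⊗-resp-≈ ≈.refl p

  ⊗≈⊗id∘id⊗ : ∀ {A B X Y} {f : Hom A B} {g : Hom X Y} → f ⊗₁ g ≈ (f ⊗₁ id) ∘ (id ⊗₁ g)
  ⊗≈⊗id∘id⊗ = ≈.trans (⊗-resp-≈ (≈.sym identityʳ) (≈.sym identityˡ)) ⊗-homomorphism

  ⊗≈id⊗∘⊗id : ∀ {A B X Y} {f : Hom A B} {g : Hom X Y} → f ⊗₁ g ≈ (id ⊗₁ g) ∘ (f ⊗₁ id)
  ⊗≈id⊗∘⊗id = ≈.trans (⊗-resp-≈ (≈.sym identityˡ) (≈.sym identityʳ)) ⊗-homomorphism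

  id⊗-∘ : ∀ {X A B D} {g : Hom B D} {f : Hom A B} →
          id {X} ⊗₁ (g ∘ f) ≈ (id ⊗₁ g) ∘ (id ⊗₁ f)
  id⊗-∘ = ≈.trans (⊗-respˡ (≈.sym identityˡ)) ⊗-homomorphism

  ∘-⊗id : ∀ {X A B D} {g : Hom B D} {f : Hom A B} →
          (g ∘ f) ⊗₁ id {X} ≈ (g ⊗₁ id) ∘ (f ⊗₁ id)
  ∘-⊗id = ≈.trans (⊗-respʳ (≈.sym identityˡ)) ⊗-homomorphism

  ⊗-inverse : ∀ {A B X Y} {f : Hom A B} {f⁻¹ : Hom B A} {g : Hom X Y} {g⁻¹ : Hom Y X} →
              f ∘ f⁻¹ ≈ id → g ∘ g⁻¹ ≈ id → (f ⊗₁ g) ∘ (f⁻¹ ⊗₁ g⁻¹) ≈ id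
  ⊗-inverse ff⁻¹ gg⁻¹ =
    ≈.trans (≈.sym ⊗-homomorphism) (≈.trans (⊗-resp-≈ ff⁻¹ gg⁻¹) ⊗-identity)

  rho∘⊗≈∘rho∘id⊗ : ∀ {A B V} {f : Hom A B} {x : Hom V I} →
                   rho B ∘ (f ⊗₁ x) ≈ f ∘ (rho A ∘ (id ⊗₁ x))
  rho∘⊗≈∘rho∘id⊗ {f = f} {x} = begin
    rho _ ∘ (f ⊗₁ x)                ≈⟨ refl⟩∘⟨ ⊗≈⊗id∘id⊗ ⟩
    rho _ ∘ ((f ⊗₁ id) ∘ (id ⊗₁ x)) ≈⟨ pullˡ rho-natural ⟩
    (f ∘ rho _) ∘ (id ⊗₁ x)         ≈⟨ assoc ⟩
    f ∘ (rho _ ∘ (id ⊗₁ x))         ∎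

  lam∘⊗≈∘lam∘⊗id : ∀ {A B V} {f : Hom A B} {x : Hom V I} →
                   lam B ∘ (x ⊗₁ f) ≈ f ∘ (lam A ∘ (x ⊗₁ id))
  lam∘⊗≈∘lam∘⊗id {f = f} {x} = begin
    lam _ ∘ (x ⊗₁ f)                ≈⟨ refl⟩∘⟨ ⊗≈id⊗∘⊗id ⟩
    lam _ ∘ ((id ⊗₁ f) ∘ (x ⊗₁ id)) ≈⟨ pullˡ lam-natural ⟩
    (f ∘ lam _) ∘ (x ⊗₁ id)         ≈⟨ assoc ⟩
    f ∘ (lam _ ∘ (x ⊗₁ id))         ∎

  ⊗I-faithful : ∀ {A B} {f g : Hom A B} → f ⊗₁ id {I} ≈ g ⊗₁ id → f ≈ g
  ⊗I-faithful {f = f} {g} p = split-epi-cancel rho-isoʳ (begin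
    f ∘ rho _         ≈⟨ ≈.sym rho-natural ⟩
    rho _ ∘ (f ⊗₁ id) ≈⟨ refl⟩∘⟨ p ⟩
    rho _ ∘ (g ⊗₁ id) ≈⟨ rho-natural ⟩
    g ∘ rho _         ∎)

  I⊗-faithful : ∀ {A B} {f g : Hom A B} → id {I} ⊗₁ f ≈ id ⊗₁ g → f ≈ g
  I⊗-faithful {f = f} {g} p = split-epi-cancel lam-isoʳ (begin
    f ∘ lam _         ≈⟨ ≈.sym lam-natural ⟩
    lam _ ∘ (id ⊗₁ f) ≈⟨ refl⟩∘⟨ p ⟩
    lam _ ∘ (id ⊗₁ g) ≈⟨ lam-natural ⟩
    g ∘ lam _         ∎)

  -- Tensor with I and precompose with the invertible P; the pentagon then
  -- turns both sides into the triangle identity.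
  rho∘α≈id⊗rho : ∀ {A B} → rho (A ⊗₀ B) ∘ α A B I ≈ id {A} ⊗₁ rho B
  rho∘α≈id⊗rho {A} {B} = ⊗I-faithful (split-epi-cancel P∘P⁻¹ (begin
    ((rho (A ⊗₀ B) ∘ α A B I) ⊗₁ id) ∘ P                 ≈⟨ ∘-⊗id ⟩∘⟨refl ⟩
    ((rho (A ⊗₀ B) ⊗₁ id) ∘ (α A B I ⊗₁ id)) ∘ P         ≈⟨ pullʳ (≈.sym pentagon) ⟩
    (rho (A ⊗₀ B) ⊗₁ id) ∘ (α (A ⊗₀ B) I I ∘ α A B (I ⊗₀ I)) ≈⟨ pullˡ triangle ⟩
    (id ⊗₁ lam I) ∘ α A B (I ⊗₀ I)                       ≈⟨ ⊗-respˡ (≈.sym ⊗-identity) ⟩∘⟨refl ⟩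
    ((id ⊗₁ id) ⊗₁ lam I) ∘ α A B (I ⊗₀ I)               ≈⟨ ≈.sym α-natural ⟩
    α A B I ∘ (id ⊗₁ (id ⊗₁ lam I))                      ≈⟨ refl⟩∘⟨ ⊗-respʳ (≈.sym triangle) ⟩
    α A B I ∘ (id ⊗₁ ((rho B ⊗₁ id) ∘ α B I I))          ≈⟨ refl⟩∘⟨ id⊗-∘ ⟩
    α A B I ∘ ((id ⊗₁ (rho B ⊗₁ id)) ∘ (id ⊗₁ α B I I))  ≈⟨ sym-assoc ⟩
    (α A B I ∘ (id ⊗₁ (rho B ⊗₁ id))) ∘ (id ⊗₁ α B I I)  ≈⟨ α-natural ⟩∘⟨refl ⟩
    (((id ⊗₁ rho B) ⊗₁ id) ∘ α A (B ⊗₀ I) I) ∘ (id ⊗₁ α B I I) ≈⟨ assoc ⟩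
    ((id ⊗₁ rho B) ⊗₁ id) ∘ P                            ∎))
    where
      P : Hom (A ⊗₀ (B ⊗₀ (I ⊗₀ I))) ((A ⊗₀ (B ⊗₀ I)) ⊗₀ I)
      P = α A (B ⊗₀ I) I ∘ (id ⊗₁ α B I I)
      P∘P⁻¹ : P ∘ ((id ⊗₁ α⁻¹ B I I) ∘ α⁻¹ A (B ⊗₀ I) I) ≈ id
      P∘P⁻¹ = inverse-∘ α-isoʳ (⊗-inverse identityʳ α-isoʳ)

  rho-I⊗I : rho (I ⊗₀ I) ≈ rho I ⊗₁ id
  rho-I⊗I = ≈.sym (split-mono-cancel rho-isoˡ rho-natural)

  rho-I≈lam-I : rho I ≈ lam I
  rho-I≈lam-I = I⊗-faithful (begin
    id ⊗₁ rho I            ≈⟨ ≈.sym rho∘α≈id⊗rho ⟩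
    rho (I ⊗₀ I) ∘ α I I I ≈⟨ rho-I⊗I ⟩∘⟨refl ⟩
    (rho I ⊗₁ id) ∘ α I I I ≈⟨ triangle ⟩
    id ⊗₁ lam I            ∎)

module CentralIdempotents {o ℓ e : Level} (C : SymmetricMonoidalCategory o ℓ e) where
  open SymmetricMonoidalCategory C
  open MonoidalReasoning C

  id-isCentralIdem : IsCentralIdem C (id {I})
  id-isCentralIdem = record
    { central   = ≈.trans (elimʳ ⊗-identity) (≈.trans rho-I≈lam-I (≈.sym (elimʳ ⊗-identity)))
    ; diag⁻¹    = rho⁻¹ I
    ; diag-isoˡ = ≈.trans (refl⟩∘⟨ elimʳ ⊗-identity) rho-isoˡ
    ; diag-isoʳ = ≈.trans (elimʳ ⊗-identity ⟩∘⟨refl) rho-isoʳ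
    }

  isCentralIdem-resp-≈ : ∀ {U} {x y : Hom U I} → x ≈ y → IsCentralIdem C x → IsCentralIdem C y
  isCentralIdem-resp-≈ x≈y isCI = record
    { central   = ≈.trans (refl⟩∘⟨ ⊗-respʳ (≈.sym x≈y)) (≈.trans central (refl⟩∘⟨ ⊗-respˡ x≈y))
    ; diag⁻¹    = diag⁻¹
    ; diag-isoˡ = ≈.trans (refl⟩∘⟨ refl⟩∘⟨ ⊗-respʳ (≈.sym x≈y)) diag-isoˡ
    ; diag-isoʳ = ≈.trans ((refl⟩∘⟨ ⊗-respʳ (≈.sym x≈y)) ⟩∘⟨refl) diag-isoʳ
    }
    where open IsCentralIdem isCI

  -- Transport along the isomorphism φ : multiplication by u ∘ φ on X is
  -- conjugate, via φ ⊗ φ and φ, to multiplication by u on U.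
  isCentralIdem-∘-iso : ∀ {U X} {u : Hom U I} {φ : Hom X U} {ψ : Hom U X} →
                        IsCentralIdem C u → φ ∘ ψ ≈ id → ψ ∘ φ ≈ id →
                        IsCentralIdem C (u ∘ φ)
  isCentralIdem-∘-iso {U} {X} {u} {φ} {ψ} isCI φψ ψφ = record
    { central   = begin
        multˡ                                  ≈⟨ multˡ-conjugate ⟩
        ψ ∘ ((rho U ∘ (id ⊗₁ u)) ∘ (φ ⊗₁ φ))   ≈⟨ refl⟩∘⟨ (central ⟩∘⟨refl) ⟩
        ψ ∘ ((lam U ∘ (u ⊗₁ id)) ∘ (φ ⊗₁ φ))   ≈⟨ refl⟩∘⟨ lam-conjugate ⟩
        ψ ∘ (φ ∘ (lam X ∘ ((u ∘ φ) ⊗₁ id)))    ≈⟨ pullˡ ψφ ⟩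
        id ∘ (lam X ∘ ((u ∘ φ) ⊗₁ id))         ≈⟨ identityˡ ⟩
        lam X ∘ ((u ∘ φ) ⊗₁ id)                ∎
    ; diag⁻¹    = (ψ ⊗₁ ψ) ∘ (diag⁻¹ ∘ φ)
    ; diag-isoˡ = ≈.trans (refl⟩∘⟨ multˡ-conjugate)
                    (inverse-∘₃ (⊗-inverse ψφ ψφ) diag-isoˡ φψ)
    ; diag-isoʳ = ≈.trans (multˡ-conjugate ⟩∘⟨refl)
                    (inverse-∘₃ ψφ diag-isoʳ (⊗-inverse φψ φψ))
    }
    where
      open IsCentralIdem isCI

      multˡ : Hom (X ⊗₀ X) X
      multˡ = rho X ∘ (id ⊗₁ (u ∘ φ))

      rho-conjugate : (rho U ∘ (id ⊗₁ u)) ∘ (φ ⊗₁ φ) ≈ φ ∘ multˡ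
      rho-conjugate = begin
        (rho U ∘ (id ⊗₁ u)) ∘ (φ ⊗₁ φ) ≈⟨ assoc ⟩
        rho U ∘ ((id ⊗₁ u) ∘ (φ ⊗₁ φ)) ≈⟨ refl⟩∘⟨ ≈.sym ⊗-homomorphism ⟩
        rho U ∘ ((id ∘ φ) ⊗₁ (u ∘ φ))  ≈⟨ refl⟩∘⟨ ⊗-respˡ identityˡ ⟩
        rho U ∘ (φ ⊗₁ (u ∘ φ))         ≈⟨ rho∘⊗≈∘rho∘id⊗ ⟩
        φ ∘ multˡ                      ∎

      multˡ-conjugate : multˡ ≈ ψ ∘ ((rho U ∘ (id ⊗₁ u)) ∘ (φ ⊗₁ φ))
      multˡ-conjugate = ≈.sym (≈.trans (refl⟩∘⟨ rho-conjugate) (≈.trans (pullˡ ψφ) identityˡ))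

      lam-conjugate : (lam U ∘ (u ⊗₁ id)) ∘ (φ ⊗₁ φ) ≈ φ ∘ (lam X ∘ ((u ∘ φ) ⊗₁ id))
      lam-conjugate = begin
        (lam U ∘ (u ⊗₁ id)) ∘ (φ ⊗₁ φ) ≈⟨ assoc ⟩
        lam U ∘ ((u ⊗₁ id) ∘ (φ ⊗₁ φ)) ≈⟨ refl⟩∘⟨ ≈.sym ⊗-homomorphism ⟩
        lam U ∘ ((u ∘ φ) ⊗₁ (id ∘ φ))  ≈⟨ refl⟩∘⟨ ⊗-respʳ identityˡ ⟩
        lam U ∘ ((u ∘ φ) ⊗₁ φ)         ≈⟨ lam∘⊗≈∘lam∘⊗id ⟩
        φ ∘ (lam X ∘ ((u ∘ φ) ⊗₁ id))  ∎

module CoKleisli {o ℓ e : Level} (C : SymmetricMonoidalCategory o ℓ e) (w : CentralIdem C) where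
  open SymmetricMonoidalCategory C
  open MonoidalReasoning C
  open CentralIdem w
  open Restriction C w

  δ : ∀ A → Hom (A ⊗₀ U) ((A ⊗₀ U) ⊗₀ U)
  δ A = α A U U ∘ (id ⊗₁ diag⁻¹)

  id∣-natural : ∀ {A B} {f : Hom A B} → id∣ B ∘ (f ⊗₁ id) ≈ f ∘ id∣ A
  id∣-natural {f = f} = begin
    (rho _ ∘ (id ⊗₁ u)) ∘ (f ⊗₁ id) ≈⟨ assoc ⟩
    rho _ ∘ ((id ⊗₁ u) ∘ (f ⊗₁ id)) ≈⟨ refl⟩∘⟨ ≈.sym ⊗≈id⊗∘⊗id ⟩
    rho _ ∘ (f ⊗₁ u)                ≈⟨ rho∘⊗≈∘rho∘id⊗ ⟩
    f ∘ id∣ _                       ∎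

  id∣-δ : ∀ {A} → id∣ (A ⊗₀ U) ∘ δ A ≈ id
  id∣-δ {A} = begin
    (rho (A ⊗₀ U) ∘ (id ⊗₁ u)) ∘ (α A U U ∘ (id ⊗₁ diag⁻¹))   ≈⟨ assoc ⟩
    rho (A ⊗₀ U) ∘ ((id ⊗₁ u) ∘ (α A U U ∘ (id ⊗₁ diag⁻¹)))   ≈⟨ refl⟩∘⟨ sym-assoc ⟩
    rho (A ⊗₀ U) ∘ (((id ⊗₁ u) ∘ α A U U) ∘ (id ⊗₁ diag⁻¹))
      ≈⟨ refl⟩∘⟨ (⊗-respˡ (≈.sym ⊗-identity) ⟩∘⟨refl) ⟩∘⟨refl ⟩
    rho (A ⊗₀ U) ∘ ((((id ⊗₁ id) ⊗₁ u) ∘ α A U U) ∘ (id ⊗₁ diag⁻¹))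
      ≈⟨ refl⟩∘⟨ ≈.sym α-natural ⟩∘⟨refl ⟩
    rho (A ⊗₀ U) ∘ ((α A U I ∘ (id ⊗₁ (id ⊗₁ u))) ∘ (id ⊗₁ diag⁻¹))
      ≈⟨ refl⟩∘⟨ assoc ⟩
    rho (A ⊗₀ U) ∘ (α A U I ∘ ((id ⊗₁ (id ⊗₁ u)) ∘ (id ⊗₁ diag⁻¹)))
      ≈⟨ pullˡ rho∘α≈id⊗rho ⟩
    (id ⊗₁ rho U) ∘ ((id ⊗₁ (id ⊗₁ u)) ∘ (id ⊗₁ diag⁻¹))     ≈⟨ refl⟩∘⟨ ≈.sym id⊗-∘ ⟩
    (id ⊗₁ rho U) ∘ (id ⊗₁ ((id ⊗₁ u) ∘ diag⁻¹))             ≈⟨ ≈.sym id⊗-∘ ⟩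
    id ⊗₁ (rho U ∘ ((id ⊗₁ u) ∘ diag⁻¹))
      ≈⟨ ⊗-respʳ (≈.trans sym-assoc diag-isoʳ) ⟩
    id ⊗₁ id                                                 ≈⟨ ⊗-identity ⟩
    id                                                       ∎

  -- Unlike id∣-δ, this counit law needs the centrality of u.
  id∣⊗id-δ : ∀ {A} → (id∣ A ⊗₁ id) ∘ δ A ≈ id
  id∣⊗id-δ {A} = begin
    ((rho A ∘ (id ⊗₁ u)) ⊗₁ id) ∘ (α A U U ∘ (id ⊗₁ diag⁻¹))   ≈⟨ ∘-⊗id ⟩∘⟨refl ⟩
    ((rho A ⊗₁ id) ∘ ((id ⊗₁ u) ⊗₁ id)) ∘ (α A U U ∘ (id ⊗₁ diag⁻¹)) ≈⟨ assoc ⟩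
    (rho A ⊗₁ id) ∘ (((id ⊗₁ u) ⊗₁ id) ∘ (α A U U ∘ (id ⊗₁ diag⁻¹)))  ≈⟨ refl⟩∘⟨ sym-assoc ⟩
    (rho A ⊗₁ id) ∘ ((((id ⊗₁ u) ⊗₁ id) ∘ α A U U) ∘ (id ⊗₁ diag⁻¹))
      ≈⟨ refl⟩∘⟨ ≈.sym α-natural ⟩∘⟨refl ⟩
    (rho A ⊗₁ id) ∘ ((α A I U ∘ (id ⊗₁ (u ⊗₁ id))) ∘ (id ⊗₁ diag⁻¹)) ≈⟨ refl⟩∘⟨ assoc ⟩
    (rho A ⊗₁ id) ∘ (α A I U ∘ ((id ⊗₁ (u ⊗₁ id)) ∘ (id ⊗₁ diag⁻¹))) ≈⟨ pullˡ triangle ⟩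
    (id ⊗₁ lam U) ∘ ((id ⊗₁ (u ⊗₁ id)) ∘ (id ⊗₁ diag⁻¹))            ≈⟨ refl⟩∘⟨ ≈.sym id⊗-∘ ⟩
    (id ⊗₁ lam U) ∘ (id ⊗₁ ((u ⊗₁ id) ∘ diag⁻¹))                    ≈⟨ ≈.sym id⊗-∘ ⟩
    id ⊗₁ (lam U ∘ ((u ⊗₁ id) ∘ diag⁻¹))
      ≈⟨ ⊗-respʳ (pullˡ (≈.sym central)) ⟩
    id ⊗₁ ((rho U ∘ (id ⊗₁ u)) ∘ diag⁻¹)                            ≈⟨ ⊗-respʳ diag-isoʳ ⟩
    id ⊗₁ id                                                        ≈⟨ ⊗-identity ⟩
    id                                                              ∎

  ∘∣-counitˡ : ∀ {A B D} {g : Hom∣ B D} {h : Hom B D} {f : Hom∣ A B} →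
               g ≈ h ∘ id∣ B → g ∘∣ f ≈ h ∘ f
  ∘∣-counitˡ {A} {B} {D} {g} {h} {f} g≈ = begin
    g ∘ ((f ⊗₁ id) ∘ δ A)             ≈⟨ g≈ ⟩∘⟨refl ⟩
    (h ∘ id∣ B) ∘ ((f ⊗₁ id) ∘ δ A)   ≈⟨ assoc ⟩
    h ∘ (id∣ B ∘ ((f ⊗₁ id) ∘ δ A))   ≈⟨ refl⟩∘⟨ pullˡ id∣-natural ⟩
    h ∘ ((f ∘ id∣ (A ⊗₀ U)) ∘ δ A)    ≈⟨ refl⟩∘⟨ pullʳ id∣-δ ⟩
    h ∘ (f ∘ id)                      ≈⟨ refl⟩∘⟨ identityʳ ⟩
    h ∘ f                             ∎

  ∘∣-counitʳ : ∀ {A B D} {g : Hom∣ B D} {h : Hom A B} {f : Hom∣ A B} →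
               f ≈ h ∘ id∣ A → g ∘∣ f ≈ g ∘ (h ⊗₁ id)
  ∘∣-counitʳ {A} {B} {D} {g} {h} {f} f≈ = begin
    g ∘ ((f ⊗₁ id) ∘ δ A)                      ≈⟨ refl⟩∘⟨ ⊗-respˡ f≈ ⟩∘⟨refl ⟩
    g ∘ (((h ∘ id∣ A) ⊗₁ id) ∘ δ A)            ≈⟨ refl⟩∘⟨ ∘-⊗id ⟩∘⟨refl ⟩
    g ∘ (((h ⊗₁ id) ∘ (id∣ A ⊗₁ id)) ∘ δ A)    ≈⟨ refl⟩∘⟨ pullʳ id∣⊗id-δ ⟩
    g ∘ ((h ⊗₁ id) ∘ id)                       ≈⟨ refl⟩∘⟨ identityʳ ⟩
    g ∘ (h ⊗₁ id)                              ∎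

module LiftedMonad {o ℓ e : Level} (C : SymmetricMonoidalCategory o ℓ e)
                   (M : Monad C) (L : Localisable C M) (w : CentralIdem C) where
  open SymmetricMonoidalCategory C
  open MonoidalReasoning C
  open CentralIdempotents C
  open Monad M
  open Localisable L
  open CentralIdem w
  open Restriction C w
  open Restricted C M L w
  open CoKleisli C w

  s : ∀ A → Hom (T₀ A ⊗₀ U) (T₀ (A ⊗₀ U))
  s A = st A u isCI

  T-homomorphism-∘ : ∀ {X A B D} {f : Hom A B} {g : Hom B D} {x : Hom X (T₀ A)} →
                     T₁ (g ∘ f) ∘ x ≈ T₁ g ∘ (T₁ f ∘ x)
  T-homomorphism-∘ = ≈.trans (T-homomorphism ⟩∘⟨refl) assoc

  st-counit : ∀ {A} → T₁ (id∣ A) ∘ s A ≈ id∣ (T₀ A)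
  st-counit {A} = begin
    T₁ (rho A ∘ (id ⊗₁ u)) ∘ s A            ≈⟨ T-homomorphism-∘ ⟩
    T₁ (rho A) ∘ (T₁ (id ⊗₁ u) ∘ s A)
      ≈⟨ refl⟩∘⟨ ≈.sym (st-m A u id u isCI id-isCentralIdem (≈.sym identityˡ)) ⟩
    T₁ (rho A) ∘ (st A id id-isCentralIdem ∘ (id ⊗₁ u)) ≈⟨ pullˡ (st-unit A id-isCentralIdem) ⟩
    rho (T₀ A) ∘ (id ⊗₁ u)                  ∎

  u⊗u : Hom (U ⊗₀ U) I
  u⊗u = rho I ∘ (u ⊗₁ u)

  u⊗u-isCentralIdem : IsCentralIdem C u⊗u
  u⊗u-isCentralIdem = isCentralIdem-resp-≈ (≈.sym rho∘⊗≈∘rho∘id⊗)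
                        (isCentralIdem-∘-iso isCI diag-isoʳ diag-isoˡ)

  u≈u⊗u∘diag⁻¹ : u ≈ u⊗u ∘ diag⁻¹
  u≈u⊗u∘diag⁻¹ = ≈.sym (≈.trans (rho∘⊗≈∘rho∘id⊗ ⟩∘⟨refl) (≈.trans (pullʳ diag-isoʳ) identityʳ))

  st-δ : ∀ {A} → T₁ (δ A) ∘ s A ≈ s (A ⊗₀ U) ∘ ((s A ⊗₁ id) ∘ δ (T₀ A))
  st-δ {A} = begin
    T₁ (α A U U ∘ (id ⊗₁ diag⁻¹)) ∘ s A        ≈⟨ T-homomorphism-∘ ⟩
    T₁ (α A U U) ∘ (T₁ (id ⊗₁ diag⁻¹) ∘ s A)
      ≈⟨ refl⟩∘⟨ ≈.sym (st-m A u u⊗u diag⁻¹ isCI u⊗u-isCentralIdem u≈u⊗u∘diag⁻¹) ⟩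
    T₁ (α A U U) ∘ (st A u⊗u u⊗u-isCentralIdem ∘ (id ⊗₁ diag⁻¹))   ≈⟨ sym-assoc ⟩
    (T₁ (α A U U) ∘ st A u⊗u u⊗u-isCentralIdem) ∘ (id ⊗₁ diag⁻¹)
      ≈⟨ st-assoc A u u isCI isCI u⊗u-isCentralIdem ⟩∘⟨refl ⟩
    (s (A ⊗₀ U) ∘ ((s A ⊗₁ id) ∘ α (T₀ A) U U)) ∘ (id ⊗₁ diag⁻¹)   ≈⟨ pullʳ assoc ⟩
    s (A ⊗₀ U) ∘ ((s A ⊗₁ id) ∘ δ (T₀ A))                         ∎

  η∣≈η∘id∣ : ∀ {A} → η∣ A ≈ η A ∘ id∣ A
  η∣≈η∘id∣ = rho∘⊗≈∘rho∘id⊗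

  μ∣≈μ∘id∣ : ∀ {A} → μ∣ A ≈ μ A ∘ id∣ (T₀ (T₀ A))
  μ∣≈μ∘id∣ = rho∘⊗≈∘rho∘id⊗

  T∣-homomorphism : ∀ {A B D} {f : Hom∣ A B} {g : Hom∣ B D} → T∣ (g ∘∣ f) ≈ T∣ g ∘∣ T∣ f
  T∣-homomorphism {A} {B} {D} {f} {g} = begin
    T₁ (g ∘ ((f ⊗₁ id) ∘ δ A)) ∘ s A                   ≈⟨ T-homomorphism-∘ ⟩
    T₁ g ∘ (T₁ ((f ⊗₁ id) ∘ δ A) ∘ s A)                ≈⟨ refl⟩∘⟨ T-homomorphism-∘ ⟩
    T₁ g ∘ (T₁ (f ⊗₁ id) ∘ (T₁ (δ A) ∘ s A))           ≈⟨ refl⟩∘⟨ refl⟩∘⟨ st-δ ⟩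
    T₁ g ∘ (T₁ (f ⊗₁ id) ∘ (s (A ⊗₀ U) ∘ ((s A ⊗₁ id) ∘ δ (T₀ A))))
      ≈⟨ refl⟩∘⟨ pullˡ (≈.sym (st-natural f u isCI)) ⟩
    T₁ g ∘ ((s B ∘ (T₁ f ⊗₁ id)) ∘ ((s A ⊗₁ id) ∘ δ (T₀ A)))
      ≈⟨ refl⟩∘⟨ pullʳ (pullˡ (≈.sym ∘-⊗id)) ⟩
    T₁ g ∘ (s B ∘ (((T₁ f ∘ s A) ⊗₁ id) ∘ δ (T₀ A)))   ≈⟨ sym-assoc ⟩
    (T₁ g ∘ s B) ∘ (((T₁ f ∘ s A) ⊗₁ id) ∘ δ (T₀ A))   ∎

  η∣-natural : ∀ {A B} {f : Hom∣ A B} → η∣ B ∘∣ f ≈ T∣ f ∘∣ η∣ A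
  η∣-natural {A} {B} {f} = begin
    η∣ B ∘∣ f                   ≈⟨ ∘∣-counitˡ η∣≈η∘id∣ ⟩
    η B ∘ f                     ≈⟨ η-natural ⟩
    T₁ f ∘ η (A ⊗₀ U)           ≈⟨ refl⟩∘⟨ st-η A u isCI ⟩
    T₁ f ∘ (s A ∘ (η A ⊗₁ id))  ≈⟨ sym-assoc ⟩
    (T₁ f ∘ s A) ∘ (η A ⊗₁ id)  ≈⟨ ≈.sym (∘∣-counitʳ η∣≈η∘id∣) ⟩
    T∣ f ∘∣ η∣ A                ∎

  μ∣-natural : ∀ {A B} {f : Hom∣ A B} → μ∣ B ∘∣ T∣ (T∣ f) ≈ T∣ f ∘∣ μ∣ A
  μ∣-natural {A} {B} {f} = begin
    μ∣ B ∘∣ T∣ (T∣ f)                             ≈⟨ ∘∣-counitˡ μ∣≈μ∘id∣ ⟩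
    μ B ∘ (T₁ (T₁ f ∘ s A) ∘ s (T₀ A))            ≈⟨ refl⟩∘⟨ T-homomorphism-∘ ⟩
    μ B ∘ (T₁ (T₁ f) ∘ (T₁ (s A) ∘ s (T₀ A)))     ≈⟨ pullˡ μ-natural ⟩
    (T₁ f ∘ μ (A ⊗₀ U)) ∘ (T₁ (s A) ∘ s (T₀ A))   ≈⟨ pullʳ (st-μ A u isCI) ⟩
    T₁ f ∘ (s A ∘ (μ A ⊗₁ id))                    ≈⟨ sym-assoc ⟩
    (T₁ f ∘ s A) ∘ (μ A ⊗₁ id)                    ≈⟨ ≈.sym (∘∣-counitʳ μ∣≈μ∘id∣) ⟩
    T∣ f ∘∣ μ∣ A                                  ∎

  T∣-on-lifted : ∀ {A B} {h : Hom A B} → T∣ (h ∘ id∣ A) ≈ T₁ h ∘ id∣ (T₀ A)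
  T∣-on-lifted = ≈.trans T-homomorphism-∘ (refl⟩∘⟨ st-counit)

  μ∣-identityˡ : ∀ {A} → μ∣ A ∘∣ T∣ (η∣ A) ≈ id∣ (T₀ A)
  μ∣-identityˡ {A} = begin
    μ∣ A ∘∣ T∣ (η∣ A)               ≈⟨ ∘∣-counitˡ μ∣≈μ∘id∣ ⟩
    μ A ∘ (T₁ (η∣ A) ∘ s A)         ≈⟨ refl⟩∘⟨ (T-resp-≈ η∣≈η∘id∣ ⟩∘⟨refl) ⟩
    μ A ∘ T∣ (η A ∘ id∣ A)          ≈⟨ refl⟩∘⟨ T∣-on-lifted ⟩
    μ A ∘ (T₁ (η A) ∘ id∣ (T₀ A))   ≈⟨ pullˡ identityˡ-M ⟩
    id ∘ id∣ (T₀ A)                 ≈⟨ identityˡ ⟩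
    id∣ (T₀ A)                      ∎

  μ∣-identityʳ : ∀ {A} → μ∣ A ∘∣ η∣ (T₀ A) ≈ id∣ (T₀ A)
  μ∣-identityʳ {A} = begin
    μ∣ A ∘∣ η∣ (T₀ A)               ≈⟨ ∘∣-counitˡ μ∣≈μ∘id∣ ⟩
    μ A ∘ η∣ (T₀ A)                 ≈⟨ refl⟩∘⟨ η∣≈η∘id∣ ⟩
    μ A ∘ (η (T₀ A) ∘ id∣ (T₀ A))   ≈⟨ pullˡ identityʳ-M ⟩
    id ∘ id∣ (T₀ A)                 ≈⟨ identityˡ ⟩
    id∣ (T₀ A)                      ∎

  μ∣-assoc : ∀ {A} → μ∣ A ∘∣ T∣ (μ∣ A) ≈ μ∣ A ∘∣ μ∣ (T₀ A)
  μ∣-assoc {A} = begin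
    μ∣ A ∘∣ T∣ (μ∣ A)                         ≈⟨ ∘∣-counitˡ μ∣≈μ∘id∣ ⟩
    μ A ∘ (T₁ (μ∣ A) ∘ s (T₀ (T₀ A)))         ≈⟨ refl⟩∘⟨ (T-resp-≈ μ∣≈μ∘id∣ ⟩∘⟨refl) ⟩
    μ A ∘ T∣ (μ A ∘ id∣ (T₀ (T₀ A)))          ≈⟨ refl⟩∘⟨ T∣-on-lifted ⟩
    μ A ∘ (T₁ (μ A) ∘ id∣ (T₀ (T₀ (T₀ A))))   ≈⟨ pullˡ assoc-M ⟩
    (μ A ∘ μ (T₀ A)) ∘ id∣ (T₀ (T₀ (T₀ A)))   ≈⟨ pullʳ (≈.sym μ∣≈μ∘id∣) ⟩
    μ A ∘ μ∣ (T₀ A)                           ≈⟨ ≈.sym (∘∣-counitˡ μ∣≈μ∘id∣) ⟩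
    μ∣ A ∘∣ μ∣ (T₀ A)                         ∎

  isMonadOnRestriction : IsMonadOnRestriction
  isMonadOnRestriction = record
    { identity     = st-counit
    ; homomorphism = T∣-homomorphism
    ; resp-≈       = λ f≈g → T-resp-≈ f≈g ⟩∘⟨refl
    ; η∣-natural   = η∣-natural
    ; μ∣-natural   = μ∣-natural
    ; identityˡ∣   = μ∣-identityˡ
    ; identityʳ∣   = μ∣-identityʳ
    ; assoc∣       = μ∣-assoc
    }

module Compatibility {o ℓ e : Level} (C : SymmetricMonoidalCategory o ℓ e)
                     (M : Monad C) (L : Localisable C M) where
  open SymmetricMonoidalCategory C
  open MonoidalReasoning C
  open Monad M
  open Localisable L

  rho∘⊗-restrict : ∀ {X Y U V} {g : Hom X Y} {x : Hom U I} {y : Hom V I} {m : Hom U V} →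
                   x ≈ y ∘ m → rho Y ∘ (g ⊗₁ x) ≈ restrict C m (rho Y ∘ (g ⊗₁ y))
  rho∘⊗-restrict x≈y∘m =
    ≈.sym (pullʳ (≈.trans (≈.sym ⊗-homomorphism) (⊗-resp-≈ identityʳ (≈.sym x≈y∘m))))

  compatibleRestriction : ∀ (a b : CentralIdem C) (m : Hom (CentralIdem.U a) (CentralIdem.U b)) →
                          CentralIdem.u a ≈ CentralIdem.u b ∘ m →
                          CompatibleRestriction C M L a b m
  compatibleRestriction a b m a≈b∘m = record
    { T-commutes = λ {A} f → begin
        T₁ (f ∘ (id ⊗₁ m)) ∘ st A (u a) (isCI a)          ≈⟨ T-homomorphism ⟩∘⟨refl ⟩
        (T₁ f ∘ T₁ (id ⊗₁ m)) ∘ st A (u a) (isCI a)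
          ≈⟨ pullʳ (≈.sym (st-m A (u a) (u b) m (isCI a) (isCI b) a≈b∘m)) ⟩
        T₁ f ∘ (st A (u b) (isCI b) ∘ (id ⊗₁ m))          ≈⟨ sym-assoc ⟩
        (T₁ f ∘ st A (u b) (isCI b)) ∘ (id ⊗₁ m)          ∎
    ; η-commutes = λ A → rho∘⊗-restrict a≈b∘m
    ; μ-commutes = λ A → rho∘⊗-restrict a≈b∘m
    }
    where open CentralIdem using (u; isCI)

proposition4p5 : ∀ {o ℓ e : Level} (C : SymmetricMonoidalCategory o ℓ e) →
    Stiff C → (M : Monad C) (L : Localisable C M) → InducesFormalMonad C M L
proposition4p5 C _ M L =
  (λ w → LiftedMonad.isMonadOnRestriction C M L w) , Compatibility.compatibleRestriction C M L
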